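{- For every integer $k$ and every integer $n\ge 3$, \[ a(n,k) = \begin{cases} a(n-1,k)+2a(n-2,k)-a(n-2+k,k) & \text{if } k\le 0,\\ a(n-1,k)+a(n-2,k)-a(n-3,k)+a(n-3-k,k) & \text{if } k\ge 0.\end{cases}\]
   Context: For an integer $k$ and a nonnegative integer $n$, $A(n,k)$ is the set of compositions $(c_1,\ldots,c_t)$ of $n$ (finite sequences of positive integers summing to $n$) such that $c_{2i-1} > c_{2i}+k$ for every $i$ with $2i\le t$ (no condition on the last part if $t$ is odd), and $a(n,k)=|A(n,k)|$. Conventions: $a(0,k)=1$ (the empty composition) and $a(m,k)=0$ for $m<0$. -}

module Defs where

open import Data.Nat using (ℕ; zero; suc; _<_; _≤_)
open import Data.Integer using (ℤ; +_; -[1+_]; _+_)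
import Data.Integer as ℤ
open import Data.List using (List; []; _∷_; length; filter; map; concatMap; upTo)
open import Data.List.Relation.Unary.All using (All)
open import Data.Bool using (Bool; true; false; _∧_)
open import Relation.Unary using (Pred; Decidable)
open import Relation.Nullary using (Dec; yes; no; ¬_)
open import Relation.Binary.PropositionalEquality using (_≡_)
open import Data.Unit using (⊤)
open import Data.Product using (_×_)
open import Level using (0ℓ)

sumL : List ℕ → ℕ
sumL []       = 0
sumL (c ∷ cs) = c Data.Nat.+ sumL cs

PairCond : ℤ → List ℕ → Set
PairCond k []             = ⊤
PairCond k (c ∷ [])       = ⊤
PairCond k (c ∷ d ∷ rest) = (+ d + k ℤ.< + c) × PairCond k rest

InA : ℕ → ℤ → List ℕ → Set
InA n k cs = All (0 <_) cs × sumL cs ≡ n × PairCond k cs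

-- Enumeration of all compositions of n (lists of positive parts summing to n).
-- compositions' fuel m : all compositions of m, with fuel ≥ m.
compositions' : ℕ → ℕ → List (List ℕ)
compositions' _        zero    = [] ∷ []
compositions' zero     (suc m) = []
compositions' (suc f) (suc m)  =
  concatMap (λ i → map (λ cs → suc i ∷ cs) (compositions' f (m Data.Nat.∸ i))) (upTo (suc m))

compositions : ℕ → List (List ℕ)
compositions n = compositions' n n

pairCond? : (k : ℤ) → Decidable (PairCond k)
pairCond? k []             = yes _
pairCond? k (c ∷ [])       = yes _
pairCond? k (c ∷ d ∷ rest) with (+ d + k) ℤ.<? (+ c) | pairCond? k rest
... | yes p | yes q = yes (p Data.Product., q)
... | no ¬p | _     = no (λ x → ¬p (Data.Product.proj₁ x))
... | yes _ | no ¬q = no (λ x → ¬q (Data.Product.proj₂ x))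

aℕ : ℕ → ℤ → ℕ
aℕ n k = length (filter (pairCond? k) (compositions n))

a : ℤ → ℤ → ℤ
a (+ n)    k = + aℕ n k
a -[1+ _ ] k = + 0

{-# OPTIONS --safe #-}
module Submission where

open import Defs
open import Data.Integer using (ℤ; +_; _+_; _-_; _*_; _≤_)
open import Data.Product using (_×_)
open import Relation.Binary.PropositionalEquality using (_≡_)

open import Data.Bool using (Bool; true; false; if_then_else_)
open import Data.Integer using (-[1+_]; -_; _⊖_; _<_; _<?_; +≤+)
import Data.Integer.Properties as ℤ
open import Algebra.Properties.CommutativeSemigroup ℤ.+-commutativeSemigroup using (interchange)
open import Data.Integer.Tactic.RingSolver using (solve-∀)
open import Data.List using (List; []; _∷_; _++_; length; filter; map; concatMap; upTo; applyUpTo)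
import Data.List.Properties as List
open import Data.Nat.Base as ℕ using (ℕ; zero; suc; _∸_; _<ᵇ_)
open import Data.Nat.ListAction using (sum)
import Data.Nat.Properties as ℕ
open import Data.Product using (_,_)
open import Function using (_∘_; id; mk⇔)
open import Relation.Nullary using (does; yes; no)
open import Relation.Nullary.Decidable using (does-⇔)
open import Relation.Binary.PropositionalEquality
  using (_≗_; refl; sym; trans; cong; cong₂; subst; subst₂; module ≡-Reasoning)
open ≡-Reasoning

-- Write α n = a(n,k) and read sequences ℕ → ℤ as power series.  An admissible composition
-- of n is empty, a single part, or an admissible pair (c, d), c > d + k, followed by an
-- admissible composition; with Q t the number of admissible pairs of total t + 2 this gives
-- α = 1 + x² (Q ⊛ α) coefficientwise.  The map (c, d) ↦ (c + 1, d + 1) matches the pairs of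
-- total t + 2 with those of total t + 4 other than (1, t + 3) and (t + 3, 1), so (1 − x²) Q
-- is a sum of threshold indicators and (1 − x)(1 − x²) Q is x^(k+1) for k ≥ 0 and
-- 1 + x − x^(−k) for k < 0.  Multiplying the first identity by (1 − x)(1 − x²) gives both recurrences.

[a+b]-[c+d]≡[a-c]+[b-d] : ∀ a b c d → (a + b) - (c + d) ≡ (a - c) + (b - d)
[a+b]-[c+d]≡[a-c]+[b-d] = solve-∀

i+j-j≡i : ∀ i j → i + j - j ≡ i
i+j-j≡i = solve-∀

i-j+j≡i : ∀ i j → i - j + j ≡ i
i-j+j≡i = solve-∀

1+i+j≡i+j+1 : ∀ i j → + 1 + i + j ≡ i + j + + 1
1+i+j≡i+j+1 = solve-∀

Seq : Set
Seq = ℕ → ℤ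

∑ : ℕ → Seq → ℤ
∑ zero    f = + 0
∑ (suc n) f = f 0 + ∑ n (f ∘ suc)

∑-cong : ∀ n {f g : Seq} → (∀ i → i ℕ.< n → f i ≡ g i) → ∑ n f ≡ ∑ n g
∑-cong zero    f≡g = refl
∑-cong (suc n) f≡g = cong₂ _+_ (f≡g 0 ℕ.z<s) (∑-cong n (λ i i<n → f≡g (suc i) (ℕ.s<s i<n)))

∑-cong-≗ : ∀ n {f g : Seq} → f ≗ g → ∑ n f ≡ ∑ n g
∑-cong-≗ n f≗g = ∑-cong n (λ i _ → f≗g i)

∑-zero : ∀ n → ∑ n (λ _ → + 0) ≡ + 0
∑-zero zero    = refl
∑-zero (suc n) = cong (_+_ (+ 0)) (∑-zero n)

∑-distrib-+ : ∀ n (f g : Seq) → ∑ n (λ i → f i + g i) ≡ ∑ n f + ∑ n g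
∑-distrib-+ zero    f g = refl
∑-distrib-+ (suc n) f g =
  trans (cong (_+_ (f 0 + g 0)) (∑-distrib-+ n (f ∘ suc) (g ∘ suc))) (interchange (f 0) (g 0) _ _)

∑-neg : ∀ n (f : Seq) → ∑ n (λ i → - f i) ≡ - ∑ n f
∑-neg zero    f = refl
∑-neg (suc n) f = trans (cong (_+_ (- f 0)) (∑-neg n (f ∘ suc))) (sym (ℤ.neg-distrib-+ (f 0) _))

∑-snoc : ∀ n (f : Seq) → ∑ (suc n) f ≡ ∑ n f + f n
∑-snoc zero    f = ℤ.+-comm (f 0) (+ 0)
∑-snoc (suc n) f = trans (cong (_+_ (f 0)) (∑-snoc n (f ∘ suc))) (sym (ℤ.+-assoc (f 0) _ _))

infixl 7 _⊛_
_⊛_ : Seq → Seq → Seq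
(f ⊛ g) n = ∑ (suc n) (λ i → f i * g (n ∸ i))

⊛-congˡ : ∀ {f f' : Seq} (g : Seq) → f ≗ f' → f ⊛ g ≗ f' ⊛ g
⊛-congˡ g f≗f' n = ∑-cong-≗ (suc n) (λ i → cong (_* g (n ∸ i)) (f≗f' i))

⊛-distribʳ-+ : ∀ (f g h : Seq) → (λ i → f i + g i) ⊛ h ≗ λ n → (f ⊛ h) n + (g ⊛ h) n
⊛-distribʳ-+ f g h n =
  trans (∑-cong-≗ (suc n) (λ i → ℤ.*-distribʳ-+ (h (n ∸ i)) (f i) (g i)))
        (∑-distrib-+ (suc n) (λ i → f i * h (n ∸ i)) (λ i → g i * h (n ∸ i)))

⊛-neg : ∀ (f g : Seq) → (λ i → - f i) ⊛ g ≗ λ n → - (f ⊛ g) n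
⊛-neg f g n =
  trans (∑-cong-≗ (suc n) (λ i → sym (ℤ.neg-distribˡ-* (f i) (g (n ∸ i)))))
        (∑-neg (suc n) (λ i → f i * g (n ∸ i)))

⊛-distribʳ-- : ∀ (f g h : Seq) → (λ i → f i - g i) ⊛ h ≗ λ n → (f ⊛ h) n - (g ⊛ h) n
⊛-distribʳ-- f g h n =
  trans (⊛-distribʳ-+ f (λ i → - g i) h n) (cong (_+_ ((f ⊛ h) n)) (⊛-neg g h n))

antidiagonal : (ℕ → Seq) → Seq
antidiagonal F t = ∑ (suc t) (λ i → F i (t ∸ i))

∑-⊛-antidiagonal : ∀ (F : ℕ → Seq) (g : Seq) N →
                   ∑ (suc N) (λ i → (F i ⊛ g) (N ∸ i)) ≡ (antidiagonal F ⊛ g) N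
∑-⊛-antidiagonal F g zero = regroup (F 0 0) (g 0)
  where
  regroup : ∀ a b → (a * b + + 0) + + 0 ≡ (a + + 0) * b + + 0
  regroup = solve-∀
∑-⊛-antidiagonal F g (suc N) = begin
  (F 0 ⊛ g) (suc N) + ∑ (suc N) (λ i → (F (suc i) ⊛ g) (N ∸ i))
    ≡⟨ cong (_+_ ((F 0 ⊛ g) (suc N))) (∑-⊛-antidiagonal (F ∘ suc) g N) ⟩
  (F 0 0 * g (suc N) + (F 0 ∘ suc ⊛ g) N) + (antidiagonal (F ∘ suc) ⊛ g) N
    ≡⟨ regroup (F 0 0) (g (suc N)) _ _ ⟩
  (F 0 0 + + 0) * g (suc N) + ((F 0 ∘ suc ⊛ g) N + (antidiagonal (F ∘ suc) ⊛ g) N)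
    ≡⟨ cong (_+_ ((F 0 0 + + 0) * g (suc N)))
            (⊛-distribʳ-+ (F 0 ∘ suc) (antidiagonal (F ∘ suc)) g N) ⟨
  (antidiagonal F ⊛ g) (suc N) ∎
  where
  regroup : ∀ a b c d → (a * b + c) + d ≡ (a + + 0) * b + (c + d)
  regroup = solve-∀

shift : ℕ → Seq → Seq
shift zero    f n       = f n
shift (suc m) f zero    = + 0
shift (suc m) f (suc n) = shift m f n

shift-cong : ∀ m {f g : Seq} → f ≗ g → shift m f ≗ shift m g
shift-cong zero    f≗g n       = f≗g n
shift-cong (suc m) f≗g zero    = refl
shift-cong (suc m) f≗g (suc n) = shift-cong m f≗g n

shift-distrib-+ : ∀ m (f g : Seq) → shift m (λ i → f i + g i) ≗ λ n → shift m f n + shift m g n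
shift-distrib-+ zero    f g n       = refl
shift-distrib-+ (suc m) f g zero    = refl
shift-distrib-+ (suc m) f g (suc n) = shift-distrib-+ m f g n

⊛-shiftˡ : ∀ m (f g : Seq) → shift m f ⊛ g ≗ shift m (f ⊛ g)
⊛-shiftˡ zero    f g n       = refl
⊛-shiftˡ (suc m) f g zero    = refl
⊛-shiftˡ (suc m) f g (suc n) = trans (ℤ.+-identityˡ _) (⊛-shiftˡ m f g n)

monomial : ℕ → Seq
monomial m = shift m λ { zero → + 1 ; (suc _) → + 0 }

⊛-identityˡ : ∀ (g : Seq) → monomial 0 ⊛ g ≗ g
⊛-identityˡ g n = trans (cong₂ _+_ (ℤ.*-identityˡ (g n)) (∑-zero n)) (ℤ.+-identityʳ (g n))

monomial-⊛ : ∀ m (g : Seq) → monomial m ⊛ g ≗ shift m g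
monomial-⊛ m g n = trans (⊛-shiftˡ m (monomial 0) g n) (shift-cong m (⊛-identityˡ g) n)

∇ : ℕ → Seq → Seq
∇ m f n = f n - shift m f n

∇-cong : ∀ m {f g : Seq} → f ≗ g → ∇ m f ≗ ∇ m g
∇-cong m f≗g n = cong₂ _-_ (f≗g n) (shift-cong m f≗g n)

∇-distrib-+ : ∀ m (f g : Seq) → ∇ m (λ i → f i + g i) ≗ λ n → ∇ m f n + ∇ m g n
∇-distrib-+ m f g n =
  trans (cong (_-_ (f n + g n)) (shift-distrib-+ m f g n)) ([a+b]-[c+d]≡[a-c]+[b-d] (f n) (g n) _ _)

∇-⊛ : ∀ m (f g : Seq) → ∇ m f ⊛ g ≗ ∇ m (f ⊛ g)
∇-⊛ m f g n = trans (⊛-distribʳ-- f (shift m f) g n) (cong (_-_ ((f ⊛ g) n)) (⊛-shiftˡ m f g n))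

⟦_⟧ : Bool → ℤ
⟦ b ⟧ = if b then + 1 else + 0

∇-threshold : ∀ j → ∇ 1 (λ u → ⟦ j <ᵇ u ⟧) ≗ monomial (suc j)
∇-threshold j       zero          = refl
∇-threshold zero    (suc zero)    = refl
∇-threshold zero    (suc (suc u)) = refl
∇-threshold (suc j) (suc zero)    = refl
∇-threshold (suc j) (suc (suc u)) = ∇-threshold j (suc u)

∇-below : ∀ j → ∇ 1 (λ u → ⟦ u <ᵇ j ⟧) ≗ λ u → monomial 0 u - monomial j u
∇-below zero          zero          = refl
∇-below zero          (suc u)       = refl
∇-below (suc j)       zero          = refl
∇-below (suc zero)    (suc zero)    = refl
∇-below (suc (suc j)) (suc zero)    = refl
∇-below (suc j)       (suc (suc u)) = ∇-below j (suc u)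

compositions'-fuel : ∀ {f f' m} → m ℕ.≤ f → m ℕ.≤ f' → compositions' f m ≡ compositions' f' m
compositions'-fuel {m = zero} _ _ = refl
compositions'-fuel {suc f} {suc f'} {suc m} (ℕ.s≤s m≤f) (ℕ.s≤s m≤f') =
  List.concatMap-cong
    (λ i → cong (map (suc i ∷_)) (compositions'-fuel (ℕ.≤-trans (ℕ.m∸n≤m m i) m≤f)
                                                     (ℕ.≤-trans (ℕ.m∸n≤m m i) m≤f')))
    (upTo (suc m))

compositions-suc : ∀ m →
  compositions (suc m) ≡ concatMap (λ i → map (suc i ∷_) (compositions (m ∸ i))) (upTo (suc m))
compositions-suc m =
  List.concatMap-cong (λ i → cong (map (suc i ∷_)) (compositions'-fuel (ℕ.m∸n≤m m i) ℕ.≤-refl))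
                      (upTo (suc m))

+sum-upTo : ∀ (h : ℕ → ℕ) n → + sum (map h (upTo n)) ≡ ∑ n (λ i → + h i)
+sum-upTo h n = trans (cong (+_ ∘ sum) (List.map-applyUpTo id h n)) (+sum-applyUpTo h n)
  where
  +sum-applyUpTo : ∀ (f : ℕ → ℕ) n → + sum (applyUpTo f n) ≡ ∑ n (λ i → + f i)
  +sum-applyUpTo f zero    = refl
  +sum-applyUpTo f (suc n) = cong (_+_ (+ f 0)) (+sum-applyUpTo (f ∘ suc) n)

+if≡⟦⟧* : ∀ b x → + (if b then x else 0) ≡ ⟦ b ⟧ * + x
+if≡⟦⟧* true  x = sym (ℤ.*-identityˡ (+ x))
+if≡⟦⟧* false x = refl

canPair : ℤ → ℕ → ℕ → Bool
canPair k c d = does (+ d + k <? + c)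

+-cancelʳ-< : ∀ i {j l} → j + i < l + i → j < l
+-cancelʳ-< i {j} {l} j+i<l+i = subst₂ _<_ (i+j-j≡i j i) (i+j-j≡i l i) (ℤ.+-monoˡ-< (- i) j+i<l+i)

canPair-suc : ∀ k c d → canPair k (suc c) (suc d) ≡ canPair k c d
canPair-suc k c d = does-⇔ (mk⇔ (+-cancelʳ-< (+ 1) ∘ subst₂ _<_ lhs rhs)
                                (subst₂ _<_ (sym lhs) (sym rhs) ∘ ℤ.+-monoˡ-< (+ 1)))
                           (+ suc d + k <? + suc c) (+ d + k <? + c)
  where
  lhs : + suc d + k ≡ + d + k + + 1
  lhs = 1+i+j≡i+j+1 (+ d) k
  rhs : + suc c ≡ + c + + 1
  rhs = ℤ.+-comm (+ 1) (+ c)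

canPair-neg : ∀ j c d → canPair -[1+ j ] c d ≡ (d <ᵇ c ℕ.+ suc j)
canPair-neg j c d = does-⇔ (mk⇔ to from) (+ d + -[1+ j ] <? + c) (+ d <? + (c ℕ.+ suc j))
  where
  to : + d + -[1+ j ] < + c → + d < + (c ℕ.+ suc j)
  to p = subst (_< + (c ℕ.+ suc j)) (i-j+j≡i (+ d) (+ suc j)) (ℤ.+-monoˡ-< (+ suc j) p)
  from : + d < + (c ℕ.+ suc j) → + d + -[1+ j ] < + c
  from p = subst (+ d + -[1+ j ] <_) (i+j-j≡i (+ c) (+ suc j)) (ℤ.+-monoˡ-< -[1+ j ] p)

module _ (k : ℤ) where

  count : List (List ℕ) → ℕ
  count = length ∘ filter (pairCond? k)

  count-++ : ∀ xss yss → count (xss ++ yss) ≡ count xss ℕ.+ count yss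
  count-++ xss yss =
    trans (cong length (List.filter-++ (pairCond? k) xss yss)) (List.length-++ (filter (pairCond? k) xss))

  count-concatMap : ∀ {A : Set} (f : A → List (List ℕ)) xs →
                    count (concatMap f xs) ≡ sum (map (count ∘ f) xs)
  count-concatMap f []       = refl
  count-concatMap f (x ∷ xs) =
    trans (count-++ (f x) (concatMap f xs)) (cong (count (f x) ℕ.+_) (count-concatMap f xs))

  count-pair : ∀ c d xss →
               count (map (c ∷_) (map (d ∷_) xss)) ≡ (if canPair k c d then count xss else 0)
  count-pair c d [] with canPair k c d
  ... | true  = refl
  ... | false = refl
  count-pair c d (cs ∷ xss) with + d + k <? + c | pairCond? k cs | count-pair c d xss
  ... | yes _ | yes _ | ih = cong suc ih
  ... | yes _ | no  _ | ih = ih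
  ... | no  _ | _     | ih = ih

  α : Seq
  α n = + aℕ n k

  aWithHead : ℕ → ℕ → ℕ
  aWithHead c m = count (map (c ∷_) (compositions m))

  α-suc : ∀ m → α (suc m) ≡ ∑ (suc m) (λ i → + aWithHead (suc i) (m ∸ i))
  α-suc m = begin
    + count (compositions (suc m))
      ≡⟨ cong (+_ ∘ count) (compositions-suc m) ⟩
    + count (concatMap startingWith (upTo (suc m)))
      ≡⟨ cong +_ (count-concatMap startingWith (upTo (suc m))) ⟩
    + sum (map (count ∘ startingWith) (upTo (suc m)))
      ≡⟨ +sum-upTo (count ∘ startingWith) (suc m) ⟩
    ∑ (suc m) (λ i → + aWithHead (suc i) (m ∸ i)) ∎
    where
    startingWith : ℕ → List (List ℕ)
    startingWith i = map (suc i ∷_) (compositions (m ∸ i))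

  aWithHead-suc : ∀ c m →
    + aWithHead c (suc m) ≡ ∑ (suc m) (λ j → ⟦ canPair k c (suc j) ⟧ * α (m ∸ j))
  aWithHead-suc c m = begin
    + count (map (c ∷_) (compositions (suc m)))
      ≡⟨ cong (+_ ∘ count ∘ map (c ∷_)) (compositions-suc m) ⟩
    + count (map (c ∷_) (concatMap startingWith (upTo (suc m))))
      ≡⟨ cong (+_ ∘ count) (List.map-concatMap (c ∷_) startingWith (upTo (suc m))) ⟩
    + count (concatMap (map (c ∷_) ∘ startingWith) (upTo (suc m)))
      ≡⟨ cong +_ (count-concatMap (map (c ∷_) ∘ startingWith) (upTo (suc m))) ⟩
    + sum (map (count ∘ map (c ∷_) ∘ startingWith) (upTo (suc m)))
      ≡⟨ +sum-upTo (count ∘ map (c ∷_) ∘ startingWith) (suc m) ⟩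
    ∑ (suc m) (λ j → + count (map (c ∷_) (startingWith j)))
      ≡⟨ ∑-cong-≗ (suc m) (λ j → trans (cong +_ (count-pair c (suc j) (compositions (m ∸ j))))
                                       (+if≡⟦⟧* (canPair k c (suc j)) (aℕ (m ∸ j) k))) ⟩
    ∑ (suc m) (λ j → ⟦ canPair k c (suc j) ⟧ * α (m ∸ j)) ∎
    where
    startingWith : ℕ → List (List ℕ)
    startingWith j = map (suc j ∷_) (compositions (m ∸ j))

  -- The parts are c = i + 1 and d = j + 1, so that pairing-suc needs no side condition.
  pairing : ℕ → Seq
  pairing i j = ⟦ canPair k (suc i) (suc j) ⟧

  Q : Seq
  Q = antidiagonal pairing

  α-suc-suc : ∀ m → α (suc (suc m)) ≡ + 1 + (Q ⊛ α) m
  α-suc-suc m = begin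
    α (2 ℕ.+ m)
      ≡⟨ α-suc (suc m) ⟩
    ∑ (2 ℕ.+ m) (λ i → + aWithHead (suc i) (suc m ∸ i))
      ≡⟨ ∑-snoc (suc m) (λ i → + aWithHead (suc i) (suc m ∸ i)) ⟩
    ∑ (suc m) (λ i → + aWithHead (suc i) (suc m ∸ i)) + + aWithHead (2 ℕ.+ m) (m ∸ m)
      ≡⟨ cong₂ _+_ (∑-cong (suc m) head-suc) (cong (+_ ∘ aWithHead (2 ℕ.+ m)) (ℕ.n∸n≡0 m)) ⟩
    ∑ (suc m) (λ i → (pairing i ⊛ α) (m ∸ i)) + + 1
      ≡⟨ cong (_+ + 1) (∑-⊛-antidiagonal pairing α m) ⟩
    (Q ⊛ α) m + + 1
      ≡⟨ ℤ.+-comm ((Q ⊛ α) m) (+ 1) ⟩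
    + 1 + (Q ⊛ α) m ∎
    where
    head-suc : ∀ i → i ℕ.< suc m → + aWithHead (suc i) (suc m ∸ i) ≡ (pairing i ⊛ α) (m ∸ i)
    head-suc i i<1+m = trans (cong (+_ ∘ aWithHead (suc i)) (ℕ.+-∸-assoc 1 (ℕ.s≤s⁻¹ i<1+m)))
                             (aWithHead-suc (suc i) (m ∸ i))

  α-via-shift : ∀ n → α n ≡ + 1 + shift 2 (Q ⊛ α) n
  α-via-shift zero                = refl
  α-via-shift (suc zero)          = refl
  α-via-shift (suc (suc m))       = α-suc-suc m

  α-recurrence : ∀ N →
    α (3 ℕ.+ N) ≡ α (2 ℕ.+ N) + α (1 ℕ.+ N) - α N + (∇ 1 (∇ 2 Q) ⊛ α) (suc N)
  α-recurrence N = begin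
    α (3 ℕ.+ N)
      ≡⟨ α-via-shift (3 ℕ.+ N) ⟩
    + 1 + γ (suc N)
      ≡⟨ regroup (γ (suc N)) (γ N) (shift 1 γ N) (shift 2 γ N) ⟩
    (+ 1 + γ N) + (+ 1 + shift 1 γ N) - (+ 1 + shift 2 γ N) + ∇ 1 (∇ 2 γ) (suc N)
      ≡⟨ cong₂ _+_ (sym (cong₂ _-_ (cong₂ _+_ (α-via-shift (2 ℕ.+ N)) (α-via-shift (1 ℕ.+ N)))
                                   (α-via-shift N))) ∇∇γ ⟩
    α (2 ℕ.+ N) + α (1 ℕ.+ N) - α N + (∇ 1 (∇ 2 Q) ⊛ α) (suc N) ∎
    where
    γ : Seq
    γ = Q ⊛ α
    regroup : ∀ a b c d → + 1 + a ≡ (+ 1 + b) + (+ 1 + c) - (+ 1 + d) + ((a - c) - (b - d))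
    regroup = solve-∀
    ∇∇γ : ∇ 1 (∇ 2 γ) (suc N) ≡ (∇ 1 (∇ 2 Q) ⊛ α) (suc N)
    ∇∇γ = trans (∇-cong 1 (λ n → sym (∇-⊛ 2 Q α n)) (suc N)) (sym (∇-⊛ 1 (∇ 2 Q) α (suc N)))

  pairing-suc : ∀ i j → pairing (suc i) (suc j) ≡ pairing i j
  pairing-suc i j = cong ⟦_⟧ (canPair-suc k (suc i) (suc j))

  Q-suc-suc : ∀ t → Q (suc (suc t)) ≡ pairing 0 (suc (suc t)) + (Q t + pairing (suc (suc t)) 0)
  Q-suc-suc t = cong (_+_ (pairing 0 (suc (suc t)))) (begin
    ∑ (suc (suc t)) inner
      ≡⟨ ∑-snoc (suc t) inner ⟩
    ∑ (suc t) inner + pairing (suc (suc t)) (t ∸ t)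
      ≡⟨ cong₂ _+_ (∑-cong (suc t) shifted) (cong (pairing (suc (suc t))) (ℕ.n∸n≡0 t)) ⟩
    Q t + pairing (suc (suc t)) 0 ∎)
    where
    inner : Seq
    inner i = pairing (suc i) (suc t ∸ i)
    shifted : ∀ i → i ℕ.< suc t → inner i ≡ pairing i (t ∸ i)
    shifted i i<1+t =
      trans (cong (pairing (suc i)) (ℕ.+-∸-assoc 1 (ℕ.s≤s⁻¹ i<1+t))) (pairing-suc i (t ∸ i))

  ∇₂Q-suc : ∀ u → ∇ 2 Q (suc u) ≡ pairing 0 (suc u) + pairing (suc u) 0
  ∇₂Q-suc zero    = drop-zeros (pairing 0 1) (pairing 1 0)
    where
    drop-zeros : ∀ a b → (a + (b + + 0)) - + 0 ≡ a + b
    drop-zeros = solve-∀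
  ∇₂Q-suc (suc t) = trans (cong (_- Q t) (Q-suc-suc t)) (cancel (pairing 0 (2 ℕ.+ t)) (Q t) _)
    where
    cancel : ∀ a q b → (a + (q + b)) - q ≡ a + b
    cancel = solve-∀

∇₂Q-nonneg : ∀ j → ∇ 2 (Q (+ j)) ≗ λ u → ⟦ j <ᵇ u ⟧
∇₂Q-nonneg j zero    = refl
∇₂Q-nonneg j (suc u) = trans (∇₂Q-suc (+ j) u) (ℤ.+-identityˡ _)

∇₂Q-neg : ∀ j → ∇ 2 (Q -[1+ j ]) ≗ λ u → ⟦ 0 <ᵇ u ⟧ + ⟦ u <ᵇ suc j ⟧
∇₂Q-neg j zero    = cong (λ b → ⟦ b ⟧ + + 0 - + 0) (canPair-neg j 1 1)
∇₂Q-neg j (suc u) = begin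
  ∇ 2 (Q -[1+ j ]) (suc u)
    ≡⟨ ∇₂Q-suc -[1+ j ] u ⟩
  ⟦ canPair -[1+ j ] 1 (2 ℕ.+ u) ⟧ + ⟦ canPair -[1+ j ] (2 ℕ.+ u) 1 ⟧
    ≡⟨ cong₂ (λ b b' → ⟦ b ⟧ + ⟦ b' ⟧) (canPair-neg j 1 (2 ℕ.+ u))
                                          (canPair-neg j (2 ℕ.+ u) 1) ⟩
  ⟦ u <ᵇ j ⟧ + + 1
    ≡⟨ ℤ.+-comm ⟦ u <ᵇ j ⟧ (+ 1) ⟩
  + 1 + ⟦ u <ᵇ j ⟧ ∎

∇∇Q-nonneg : ∀ j → ∇ 1 (∇ 2 (Q (+ j))) ≗ monomial (suc j)
∇∇Q-nonneg j u = trans (∇-cong 1 (∇₂Q-nonneg j) u) (∇-threshold j u)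

∇∇Q-neg : ∀ j → ∇ 1 (∇ 2 (Q -[1+ j ])) ≗ λ u → monomial 1 u + (monomial 0 u - monomial (suc j) u)
∇∇Q-neg j u = begin
  ∇ 1 (∇ 2 (Q -[1+ j ])) u
    ≡⟨ ∇-cong 1 (∇₂Q-neg j) u ⟩
  ∇ 1 (λ v → ⟦ 0 <ᵇ v ⟧ + ⟦ v <ᵇ suc j ⟧) u
    ≡⟨ ∇-distrib-+ 1 (λ v → ⟦ 0 <ᵇ v ⟧) (λ v → ⟦ v <ᵇ suc j ⟧) u ⟩
  ∇ 1 (λ v → ⟦ 0 <ᵇ v ⟧) u + ∇ 1 (λ v → ⟦ v <ᵇ suc j ⟧) u
    ≡⟨ cong₂ _+_ (∇-threshold 0 u) (∇-below (suc j) u) ⟩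
  monomial 1 u + (monomial 0 u - monomial (suc j) u) ∎

recurrence-nonneg : ∀ j N →
  α (+ j) (3 ℕ.+ N) ≡ α (+ j) (2 ℕ.+ N) + α (+ j) (1 ℕ.+ N) - α (+ j) N + shift j (α (+ j)) N
recurrence-nonneg j N =
  trans (α-recurrence (+ j) N)
        (cong (_+_ (α (+ j) (2 ℕ.+ N) + α (+ j) (1 ℕ.+ N) - α (+ j) N))
              (trans (⊛-congˡ (α (+ j)) (∇∇Q-nonneg j) (suc N)) (monomial-⊛ (suc j) (α (+ j)) (suc N))))

recurrence-neg : ∀ j N → let k = -[1+ j ] in
  α k (3 ℕ.+ N) ≡ α k (2 ℕ.+ N) + + 2 * α k (1 ℕ.+ N) - shift (suc j) (α k) (suc N)
recurrence-neg j N = begin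
  α k (3 ℕ.+ N)                                 ≡⟨ α-recurrence k N ⟩
  y + z - w + (∇ 1 (∇ 2 (Q k)) ⊛ α k) (suc N)  ≡⟨ cong (_+_ (y + z - w)) kernel ⟩
  y + z - w + (w + (z - s))                     ≡⟨ regroup y z w s ⟩
  y + + 2 * z - s                               ∎
  where
  k : ℤ
  k = -[1+ j ]
  y z w s : ℤ
  y = α k (2 ℕ.+ N)
  z = α k (1 ℕ.+ N)
  w = α k N
  s = shift (suc j) (α k) (suc N)
  x^_⊛α : ℕ → ℤ
  x^ m ⊛α = (monomial m ⊛ α k) (suc N)
  kernel : (∇ 1 (∇ 2 (Q k)) ⊛ α k) (suc N) ≡ w + (z - s)
  kernel = begin
    (∇ 1 (∇ 2 (Q k)) ⊛ α k) (suc N)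
      ≡⟨ ⊛-congˡ (α k) (∇∇Q-neg j) (suc N) ⟩
    ((λ u → monomial 1 u + (monomial 0 u - monomial (suc j) u)) ⊛ α k) (suc N)
      ≡⟨ ⊛-distribʳ-+ (monomial 1) (λ u → monomial 0 u - monomial (suc j) u) (α k) (suc N) ⟩
    x^ 1 ⊛α + ((λ u → monomial 0 u - monomial (suc j) u) ⊛ α k) (suc N)
      ≡⟨ cong (_+_ (x^ 1 ⊛α)) (⊛-distribʳ-- (monomial 0) (monomial (suc j)) (α k) (suc N)) ⟩
    x^ 1 ⊛α + (x^ 0 ⊛α - x^ suc j ⊛α)
      ≡⟨ cong₂ _+_ (monomial-⊛ 1 (α k) (suc N))
                   (cong₂ _-_ (monomial-⊛ 0 (α k) (suc N)) (monomial-⊛ (suc j) (α k) (suc N))) ⟩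
    w + (z - s) ∎
  regroup : ∀ y z w s → y + z - w + (w + (z - s)) ≡ y + + 2 * z - s
  regroup = solve-∀

shift-α≡a : ∀ k j m → shift j (α k) m ≡ a (m ⊖ j) k
shift-α≡a k zero    m       = refl
shift-α≡a k (suc j) zero    = refl
shift-α≡a k (suc j) (suc m) =
  trans (shift-α≡a k j m) (cong (λ x → a x k) (sym (ℤ.[1+m]⊖[1+n]≡m⊖n m j)))

theorem4p2 : (k n : ℤ) → + 3 ≤ n →
    (k ≤ + 0 → a n k ≡ a (n - + 1) k + + 2 * a (n - + 2) k - a (n - + 2 + k) k) ×
    (+ 0 ≤ k → a n k ≡ a (n - + 1) k + a (n - + 2) k - a (n - + 3) k + a (n - + 3 - k) k)
theorem4p2 (+ j) (+ suc (suc (suc N))) (+≤+ (ℕ.s≤s (ℕ.s≤s (ℕ.s≤s _)))) =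
  (λ { (+≤+ ℕ.z≤n) → begin
    α (+ 0) (3 ℕ.+ N)                ≡⟨ recurrence-nonneg 0 N ⟩
    y + z - w + w                    ≡⟨ regroup y z w ⟩
    y + + 2 * z - z                  ≡⟨ cong (λ m → y + + 2 * z - α (+ 0) m) (ℕ.+-identityʳ (suc N)) ⟨
    y + + 2 * z - α (+ 0) (suc N ℕ.+ 0) ∎ }) ,
  λ _ → trans (recurrence-nonneg j N)
              (cong (_+_ (α (+ j) (2 ℕ.+ N) + α (+ j) (1 ℕ.+ N) - α (+ j) N))
                    (trans (shift-α≡a (+ j) j N) (cong (λ x → a x (+ j)) (sym (ℤ.m-n≡m⊖n N j)))))
  where
  y z w : ℤ
  y = α (+ 0) (2 ℕ.+ N)
  z = α (+ 0) (1 ℕ.+ N)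
  w = α (+ 0) N
  regroup : ∀ y z w → y + z - w + w ≡ y + + 2 * z - z
  regroup = solve-∀
theorem4p2 -[1+ j ] (+ suc (suc (suc N))) (+≤+ (ℕ.s≤s (ℕ.s≤s (ℕ.s≤s _)))) =
  (λ _ → trans (recurrence-neg j N)
               (cong (_-_ (α -[1+ j ] (2 ℕ.+ N) + + 2 * α -[1+ j ] (1 ℕ.+ N)))
                     (shift-α≡a -[1+ j ] (suc j) (suc N)))) ,
  λ ()
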